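{- Consider a misère partizan Kayles position. If Left can win it (moving next), then she can win by placing her square at the end of a strip of length congruent to $1$ modulo $3$ when such a move is possible, or at the end of a strip of length congruent to $2$ modulo $3$ otherwise. If Right can win it (moving next), then he can win by placing his domino at the end of a strip of length congruent to $2$ modulo $3$ when such a move is possible, or one cell away from the end of a strip of length congruent to $1$ modulo $3$ otherwise.
   Context: Partizan Kayles is played on $1\times n$ strips of squares. Left moves by placing a single square on one empty cell; Right moves by placing a domino covering two adjacent empty cells of the same strip; a placement splits a strip into the strips of empty cells on either side, so positions are disjunctive sums of strips of empty cells. Under misère play a player unable to move on their turn wins. -}

module Defs where

open import Data.Nat using (ℕ; zero; suc; _+_; _%_; _≤_)
open import Data.List using (List; []; _∷_; _++_)
open import Data.List.Relation.Unary.Any using (Any)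
open import Data.Product using (Σ; ∃; _×_; _,_)
open import Relation.Binary.PropositionalEquality using (_≡_)
open import Relation.Nullary using (¬_)

-- A position: a disjunctive sum of strips, given by the list of the
-- lengths of its strips of empty cells (strips of length 0 are harmless).
Pos : Set
Pos = List ℕ

-- Left places a square on a strip of length a + 1 + b, leaving strips a and b.
data LMove : Pos → Pos → Set where
  lput : (xs ys : Pos) (a b : ℕ) →
         LMove (xs ++ suc (a + b) ∷ ys) (xs ++ a ∷ b ∷ ys)

-- Right places a domino on a strip of length a + 2 + b, leaving strips a and b.
data RMove : Pos → Pos → Set where
  rput : (xs ys : Pos) (a b : ℕ) →
         RMove (xs ++ suc (suc (a + b)) ∷ ys) (xs ++ a ∷ b ∷ ys)

-- Misère play: a player unable to move on their turn wins.
-- RLoses P : Right, moving first in P, loses against some Left strategy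
--            (i.e. Left, moving second, has a winning strategy).
mutual
  data LWins : Pos → Set where
    l-nomove : {P : Pos} → (∀ Q → ¬ LMove P Q) → LWins P
    l-move   : {P Q : Pos} → LMove P Q → RLoses Q → LWins P

  data RLoses : Pos → Set where
    r-loses : {P : Pos} → (∃ λ Q → RMove P Q) →
              (∀ Q → RMove P Q → LWins Q) → RLoses P

mutual
  data RWins : Pos → Set where
    r-nomove : {P : Pos} → (∀ Q → ¬ RMove P Q) → RWins P
    r-move   : {P Q : Pos} → RMove P Q → LLoses Q → RWins P

  data LLoses : Pos → Set where
    l-loses : {P : Pos} → (∃ λ Q → LMove P Q) →
              (∀ Q → LMove P Q → RWins Q) → LLoses P

LeftEndWin : ℕ → Pos → Set
LeftEndWin r P = Σ Pos λ xs → Σ Pos λ ys → Σ ℕ λ b →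
  (P ≡ xs ++ suc b ∷ ys) × (suc b % 3 ≡ r) × RLoses (xs ++ 0 ∷ b ∷ ys)

RightEndWin : Pos → Set
RightEndWin P = Σ Pos λ xs → Σ Pos λ ys → Σ ℕ λ b →
  (P ≡ xs ++ suc (suc b) ∷ ys) × (suc (suc b) % 3 ≡ 2) × LLoses (xs ++ 0 ∷ b ∷ ys)

-- Right's domino one cell away from the end of a strip of length 3 + b
-- (covering cells 2 and 3; result: 1 and b), the strip having length
-- ≡ 1 (mod 3), is a winning move.
RightNearEndWin : Pos → Set
RightNearEndWin P = Σ Pos λ xs → Σ Pos λ ys → Σ ℕ λ b →
  (P ≡ xs ++ suc (suc (suc b)) ∷ ys) × (suc (suc (suc b)) % 3 ≡ 1) × LLoses (xs ++ 1 ∷ b ∷ ys)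

-- Give a strip of length n the weight w n = 0, -1, +1 according as
-- n ≡ 0, 1, 2 (mod 3), and a position P the weight D P, the sum of the
-- weights of its strips.  A square of Left changes D by +1 or by -2, a
-- domino of Right by -1 or by +2.  Left can always move with effect +1,
-- except when every strip has length 0 or 2 (then she either has no move
-- at all and D = 0, or can move with effect -2 while D > 0); Right can
-- always move with effect -1 unless all strips have length ≤ 1, in which
-- case D ≤ 0.  By well-founded induction on the total number of cells this
-- yields the outcome of every position:
--   Left moving first wins   iff  D ∈ {0, 3, 6, …},
--   Right moving first loses iff  D ∈ {1, 4, 7, …}.
-- Since a first player cannot both win and lose, the winning positions of
-- either player have the corresponding value of D.  The theorem follows:
-- each of the four end moves changes D by the required +1, -2 or -1.
module Submission where

open import Defs
open import Data.Nat using (ℕ; _%_; _≤_)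
open import Data.List.Relation.Unary.Any using (Any)
open import Data.Product using (_×_)
open import Relation.Binary.PropositionalEquality using (_≡_)
open import Relation.Nullary using (¬_)

open import Data.Nat as ℕ using (zero; suc; _*_; _/_; _<_; z≤n; s≤s)
import Data.Nat.Properties as ℕP
open import Data.Nat.DivMod using (m≡m%n+[m/n]*n; m*n%n≡0; m%n<n)
open import Data.Nat.Induction using (<-wellFounded)
open import Induction.WellFounded using (Acc; acc)
open import Data.Integer using (ℤ; +_; -[1+_]; _+_; +≤+; +<+; -≤+)
  renaming (_≤_ to _≤ℤ_; _<_ to _<ℤ_)
import Data.Integer.Properties as ℤP
open import Algebra.Properties.CommutativeSemigroup ℤP.+-commutativeSemigroup
  using (xy∙z≈xz∙y)
open import Data.List using ([]; _∷_; _++_)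
open import Data.Nat.ListAction using (sum)
open import Data.List.Relation.Unary.Any using (here; there)
open import Data.List.Relation.Unary.All using (All; []; _∷_)
open import Data.List.Relation.Unary.All.Properties using (++⁻ʳ; ¬Any⇒All¬)
open import Data.List.Membership.Propositional using (find)
open import Data.List.Membership.Propositional.Properties using (∈-∃++)
open import Data.Product using (Σ; ∃; _,_)
open import Data.Sum using (_⊎_; inj₁; inj₂)
open import Data.Empty using (⊥-elim)
open import Relation.Nullary using (Dec; yes; no)
open import Relation.Binary.PropositionalEquality
  using (refl; sym; trans; cong; subst; module ≡-Reasoning)

w : ℕ → ℤ
w 0 = + 0
w 1 = -[1+ 0 ]
w 2 = + 1
w (suc (suc (suc n))) = w n

D : Pos → ℤ
D [] = + 0
D (n ∷ P) = w n + D P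

w-period : ∀ r q → w (r ℕ.+ q * 3) ≡ w r
w-period r q = trans (cong w (ℕP.+-comm r (q * 3))) (go q)
  where
  go : ∀ q → w (q * 3 ℕ.+ r) ≡ w r
  go zero = refl
  go (suc q) = go q

mod3-form : ∀ n {r} → n % 3 ≡ r → ∃ λ q → n ≡ r ℕ.+ q * 3
mod3-form n h =
  n / 3 , trans (m≡m%n+[m/n]*n n 3) (cong (λ r → r ℕ.+ (n / 3) * 3) h)

w-residue : ∀ n {r} → n % 3 ≡ r → w n ≡ w r
w-residue n {r} h with q , e ← mod3-form n h = trans (cong w e) (w-period r q)

D-cons : ∀ n P Q {δ} → D Q ≡ D P + δ → D (n ∷ Q) ≡ D (n ∷ P) + δ
D-cons n P Q {δ} d = trans (cong (_+_ (w n)) d) (sym (ℤP.+-assoc (w n) (D P) δ))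

D-replace : ∀ xs ys a b n δ → w a + w b ≡ w n + δ →
            D (xs ++ a ∷ b ∷ ys) ≡ D (xs ++ n ∷ ys) + δ
D-replace [] ys a b n δ e = begin
  w a + (w b + D ys)   ≡⟨ sym (ℤP.+-assoc (w a) (w b) (D ys)) ⟩
  (w a + w b) + D ys   ≡⟨ cong (_+ D ys) e ⟩
  (w n + δ) + D ys     ≡⟨ xy∙z≈xz∙y (w n) δ (D ys) ⟩
  (w n + D ys) + δ     ∎
  where open ≡-Reasoning
D-replace (x ∷ xs) ys a b n δ e =
  D-cons x (xs ++ n ∷ ys) (xs ++ a ∷ b ∷ ys) (D-replace xs ys a b n δ e)

size-replace : ∀ xs ys {a b n} → a ℕ.+ b < n →
               sum (xs ++ a ∷ b ∷ ys) < sum (xs ++ n ∷ ys)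
size-replace [] ys {a} {b} {n} lt =
  subst (_< n ℕ.+ sum ys) (ℕP.+-assoc a b (sum ys)) (ℕP.+-monoˡ-< (sum ys) lt)
size-replace (x ∷ xs) ys lt = ℕP.+-monoʳ-< x (size-replace xs ys lt)

left-shrinks : ∀ {P Q} → LMove P Q → sum Q < sum P
left-shrinks (lput xs ys a b) = size-replace xs ys (ℕP.n<1+n (a ℕ.+ b))

right-shrinks : ∀ {P Q} → RMove P Q → sum Q < sum P
right-shrinks (rput xs ys a b) =
  size-replace xs ys (ℕP.m<n⇒m<1+n (ℕP.n<1+n (a ℕ.+ b)))

LeftΔ : ℤ → ℤ → Set
LeftΔ x y = (y ≡ x + + 1) ⊎ (y ≡ x + -[1+ 1 ])

RightΔ : ℤ → ℤ → Set
RightΔ x y = (y ≡ x + -[1+ 0 ]) ⊎ (y ≡ x + + 2)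

left-split-effect : ∀ a b → LeftΔ (w (suc (a ℕ.+ b))) (w a + w b)
left-split-effect (suc (suc (suc a))) b = left-split-effect a b
left-split-effect 0 0 = inj₁ refl
left-split-effect 0 1 = inj₂ refl
left-split-effect 0 2 = inj₁ refl
left-split-effect 0 (suc (suc (suc b))) = left-split-effect 0 b
left-split-effect 1 0 = inj₂ refl
left-split-effect 1 1 = inj₂ refl
left-split-effect 1 2 = inj₁ refl
left-split-effect 1 (suc (suc (suc b))) = left-split-effect 1 b
left-split-effect 2 0 = inj₁ refl
left-split-effect 2 1 = inj₁ refl
left-split-effect 2 2 = inj₁ refl
left-split-effect 2 (suc (suc (suc b))) = left-split-effect 2 b

right-split-effect : ∀ a b → RightΔ (w (suc (suc (a ℕ.+ b)))) (w a + w b)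
right-split-effect (suc (suc (suc a))) b = right-split-effect a b
right-split-effect 0 0 = inj₁ refl
right-split-effect 0 1 = inj₁ refl
right-split-effect 0 2 = inj₂ refl
right-split-effect 0 (suc (suc (suc b))) = right-split-effect 0 b
right-split-effect 1 0 = inj₁ refl
right-split-effect 1 1 = inj₁ refl
right-split-effect 1 2 = inj₁ refl
right-split-effect 1 (suc (suc (suc b))) = right-split-effect 1 b
right-split-effect 2 0 = inj₂ refl
right-split-effect 2 1 = inj₁ refl
right-split-effect 2 2 = inj₂ refl
right-split-effect 2 (suc (suc (suc b))) = right-split-effect 2 b

left-effect : ∀ {P Q} → LMove P Q → LeftΔ (D P) (D Q)
left-effect (lput xs ys a b) with left-split-effect a b
... | inj₁ e = inj₁ (D-replace xs ys a b (suc (a ℕ.+ b)) (+ 1) e)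
... | inj₂ e = inj₂ (D-replace xs ys a b (suc (a ℕ.+ b)) -[1+ 1 ] e)

right-effect : ∀ {P Q} → RMove P Q → RightΔ (D P) (D Q)
right-effect (rput xs ys a b) with right-split-effect a b
... | inj₁ e = inj₁ (D-replace xs ys a b (suc (suc (a ℕ.+ b))) -[1+ 0 ] e)
... | inj₂ e = inj₂ (D-replace xs ys a b (suc (suc (a ℕ.+ b))) (+ 2) e)

left-plus-split : ∀ m → (m ≡ 1) ⊎
  (Σ ℕ λ a → Σ ℕ λ b → (a ℕ.+ b ≡ m) × (w a + w b ≡ w (suc m) + + 1))
left-plus-split 0 = inj₂ (0 , 0 , refl , refl)
left-plus-split 1 = inj₁ refl
left-plus-split 2 = inj₂ (0 , 2 , refl , refl)
left-plus-split (suc (suc (suc m))) with left-plus-split m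
... | inj₁ refl = inj₂ (2 , 2 , refl , refl)
... | inj₂ (a , b , refl , e) = inj₂ (suc (suc (suc a)) , b , refl , e)

right-minus-split : ∀ m →
  Σ ℕ λ a → Σ ℕ λ b →
    (a ℕ.+ b ≡ m) × (w a + w b ≡ w (suc (suc m)) + -[1+ 0 ])
right-minus-split 0 = 0 , 0 , refl , refl
right-minus-split 1 = 0 , 1 , refl , refl
right-minus-split 2 = 1 , 1 , refl , refl
right-minus-split (suc (suc (suc m))) with right-minus-split m
... | a , b , refl , e = suc (suc (suc a)) , b , refl , e

data LeftOptions (P : Pos) : Set where
  no-square : All (_≡ 0) P → LeftOptions P
  plus-one  : ∀ {Q} → LMove P Q → D Q ≡ D P + + 1 → LeftOptions P
  minus-two : ∀ {Q} → LMove P Q → D Q ≡ D P + -[1+ 1 ] → + 0 <ℤ D P →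
              LeftOptions P

data RightOptions (P : Pos) : Set where
  no-domino : All (_≤ 1) P → RightOptions P
  minus-one : ∀ {Q} → RMove P Q → D Q ≡ D P + -[1+ 0 ] → RightOptions P

D-empty : ∀ {P} → All (_≡ 0) P → D P ≡ + 0
D-empty [] = refl
D-empty (refl ∷ z) = trans (ℤP.+-identityˡ _) (D-empty z)

lift-L : ∀ {P Q} n → LMove P Q → LMove (n ∷ P) (n ∷ Q)
lift-L n (lput xs ys a b) = lput (n ∷ xs) ys a b

lift-R : ∀ {P Q} n → RMove P Q → RMove (n ∷ P) (n ∷ Q)
lift-R n (rput xs ys a b) = rput (n ∷ xs) ys a b

-- By recursion on the strips: a strip of length m + 1 with m ≢ 1 offers a
-- move of effect +1; a strip of length 2 adds 1 to D and offers a move of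
-- effect -2 (cutting it into 0 and 1).
left-options : ∀ P → LeftOptions P
left-options [] = no-square []
left-options (zero ∷ P) with left-options P
... | no-square z = no-square (refl ∷ z)
... | plus-one {Q} mv d = plus-one (lift-L 0 mv) (D-cons 0 P Q d)
... | minus-two {Q} mv d pos =
  minus-two (lift-L 0 mv) (D-cons 0 P Q d) (ℤP.+-mono-≤-< (ℤP.≤-refl {+ 0}) pos)
left-options (suc m ∷ P) with left-plus-split m
... | inj₂ (a , b , refl , e) =
  plus-one (lput [] P a b) (D-replace [] P a b (suc (a ℕ.+ b)) (+ 1) e)
... | inj₁ refl with left-options P
...   | plus-one {Q} mv d = plus-one (lift-L 2 mv) (D-cons 2 P Q d)
...   | no-square z =
  minus-two (lput [] P 0 1) (D-replace [] P 0 1 2 -[1+ 1 ] refl) (two-first (D-empty z))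
  where
  two-first : D P ≡ + 0 → + 0 <ℤ + 1 + D P
  two-first e = subst (λ x → + 0 <ℤ + 1 + x) (sym e) (+<+ (s≤s z≤n))
...   | minus-two {Q} mv d pos =
  minus-two (lift-L 2 mv) (D-cons 2 P Q d)
    (ℤP.+-mono-<-≤ (+<+ (s≤s z≤n)) (ℤP.<⇒≤ pos))

right-cons : ∀ {P n} → n ≤ 1 → RightOptions P → RightOptions (n ∷ P)
right-cons n≤1 (no-domino z) = no-domino (n≤1 ∷ z)
right-cons {P} {n} _ (minus-one {Q} mv d) = minus-one (lift-R n mv) (D-cons n P Q d)

right-options : ∀ P → RightOptions P
right-options [] = no-domino []
right-options (0 ∷ P) = right-cons z≤n (right-options P)
right-options (1 ∷ P) = right-cons (s≤s z≤n) (right-options P)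
right-options (suc (suc m) ∷ P) with right-minus-split m
... | a , b , refl , e =
  minus-one (rput [] P a b) (D-replace [] P a b (suc (suc m)) -[1+ 0 ] e)

no-square-no-move : ∀ {P Q} → All (_≡ 0) P → ¬ LMove P Q
no-square-no-move z (lput xs ys a b) with ++⁻ʳ xs z
... | () ∷ _

no-domino-no-move : ∀ {P Q} → All (_≤ 1) P → ¬ RMove P Q
no-domino-no-move z (rput xs ys a b) with ++⁻ʳ xs z
... | s≤s () ∷ _

D-no-domino : ∀ {P} → All (_≤ 1) P → D P ≤ℤ + 0
D-no-domino [] = ℤP.≤-refl
D-no-domino (z≤n ∷ z) = ℤP.+-mono-≤ (ℤP.≤-refl {+ 0}) (D-no-domino z)
D-no-domino (s≤s z≤n ∷ z) = ℤP.+-mono-≤ -≤+ (D-no-domino z)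

w-nonneg : ∀ n → ¬ n % 3 ≡ 1 → + 0 ≤ℤ w n
w-nonneg n n≢1 =
  subst (+ 0 ≤ℤ_) (sym (w-residue n refl)) (small (n % 3) (m%n<n n 3) n≢1)
  where
  small : ∀ r → r < 3 → ¬ r ≡ 1 → + 0 ≤ℤ w r
  small 0 _ _ = +≤+ z≤n
  small 1 _ r≢1 = ⊥-elim (r≢1 refl)
  small 2 _ _ = +≤+ z≤n
  small (suc (suc (suc _))) (s≤s (s≤s (s≤s ()))) _

w-pos : ∀ n → n % 3 ≡ 2 → + 0 <ℤ w n
w-pos n h = subst (+ 0 <ℤ_) (sym (w-residue n h)) (+<+ (s≤s z≤n))

D-nonneg : ∀ {P} → All (λ n → ¬ n % 3 ≡ 1) P → + 0 ≤ℤ D P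
D-nonneg [] = ℤP.≤-refl
D-nonneg {n ∷ _} (n≢1 ∷ z) = ℤP.+-mono-≤ (w-nonneg n n≢1) (D-nonneg z)

D-pos : ∀ {P} → All (λ n → ¬ n % 3 ≡ 1) P → Any (λ n → n % 3 ≡ 2) P →
        + 0 <ℤ D P
D-pos {n ∷ _} (_ ∷ z) (here h) = ℤP.+-mono-<-≤ (w-pos n h) (D-nonneg z)
D-pos {n ∷ _} (n≢1 ∷ z) (there a) = ℤP.+-mono-≤-< (w-nonneg n n≢1) (D-pos z a)

In3ℕ : ℤ → Set
In3ℕ x = Σ ℕ λ k → x ≡ + (k * 3)

In3ℕ+1 : ℤ → Set
In3ℕ+1 x = Σ ℕ λ k → x ≡ + suc (k * 3)

in3ℕ? : ∀ x → Dec (In3ℕ x)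
in3ℕ? -[1+ n ] = no λ { (_ , ()) }
in3ℕ? (+ n) with n % 3 ℕ.≟ 0
... | yes h with q , e ← mod3-form n h = yes (q , cong +_ e)
... | no h =
  no λ { (k , e) → h (trans (cong (_% 3) (ℤP.+-injective e)) (m*n%n≡0 k 3)) }

plus-one-step : ∀ {x} → In3ℕ x → In3ℕ+1 (x + + 1)
plus-one-step (k , refl) = k , cong +_ (ℕP.+-comm (k * 3) 1)

minus-two-step : ∀ {x} → In3ℕ x → + 0 <ℤ x → In3ℕ+1 (x + -[1+ 1 ])
minus-two-step (zero , refl) (+<+ ())
minus-two-step (suc k , refl) _ = k , refl

minus-one-step : ∀ {x} → In3ℕ+1 x → In3ℕ (x + -[1+ 0 ])
minus-one-step (k , refl) = k , refl

plus-two-step : ∀ {x} → In3ℕ+1 x → In3ℕ (x + + 2)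
plus-two-step (k , refl) = suc k , cong +_ (ℕP.+-comm (suc (k * 3)) 2)

undo : ∀ x δ δ' → δ + δ' ≡ + 0 → (x + δ) + δ' ≡ x
undo x δ δ' e =
  trans (ℤP.+-assoc x δ δ') (trans (cong (_+_ x) e) (ℤP.+-identityʳ x))

right-reply : ∀ {x y} → RightΔ x y → In3ℕ+1 x → In3ℕ y
right-reply (inj₁ refl) i = minus-one-step i
right-reply (inj₂ refl) i = plus-two-step i

left-move-back : ∀ {x y} → LeftΔ x y → In3ℕ+1 y → In3ℕ x
left-move-back {x} (inj₁ refl) i =
  subst In3ℕ (undo x (+ 1) -[1+ 0 ] refl) (minus-one-step i)
left-move-back {x} (inj₂ refl) i =
  subst In3ℕ (undo x -[1+ 1 ] (+ 2) refl) (plus-two-step i)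

minus-one-back : ∀ {x y} → y ≡ x + -[1+ 0 ] → In3ℕ y → In3ℕ+1 x
minus-one-back {x} refl i =
  subst In3ℕ+1 (undo x -[1+ 0 ] (+ 1) refl) (plus-one-step i)

mutual
  left-wins : ∀ {P} → Acc _<_ (sum P) → In3ℕ (D P) → LWins P
  left-wins {P} (acc rs) i with left-options P
  ... | no-square z = l-nomove λ _ → no-square-no-move z
  ... | plus-one mv d =
    l-move mv (right-loses (rs (left-shrinks mv))
                (subst In3ℕ+1 (sym d) (plus-one-step i)))
  ... | minus-two mv d pos =
    l-move mv (right-loses (rs (left-shrinks mv))
                (subst In3ℕ+1 (sym d) (minus-two-step i pos)))

  right-loses : ∀ {P} → Acc _<_ (sum P) → In3ℕ+1 (D P) → RLoses P
  right-loses {P} (acc rs) (k , e) with right-options P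
  ... | no-domino z =
    ⊥-elim (ℤP.<⇒≱ (+<+ (s≤s z≤n)) (subst (_≤ℤ + 0) e (D-no-domino z)))
  ... | minus-one mv _ = r-loses (_ , mv) λ Q mv' →
    left-wins (rs (right-shrinks mv')) (right-reply (right-effect mv') (k , e))

  left-loses : ∀ {P} → Acc _<_ (sum P) → ¬ In3ℕ (D P) → LLoses P
  left-loses {P} (acc rs) ¬i = l-loses some-move λ Q mv →
    right-wins (rs (left-shrinks mv))
      (λ i' → ¬i (left-move-back (left-effect mv) i'))
    where
    some-move : ∃ λ Q → LMove P Q
    some-move with left-options P
    ... | no-square z = ⊥-elim (¬i (0 , D-empty z))
    ... | plus-one mv _ = _ , mv
    ... | minus-two mv _ _ = _ , mv

  right-wins : ∀ {P} → Acc _<_ (sum P) → ¬ In3ℕ+1 (D P) → RWins P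
  right-wins {P} (acc rs) ¬i with right-options P
  ... | no-domino z = r-nomove λ _ → no-domino-no-move z
  ... | minus-one mv d =
    r-move mv (left-loses (rs (right-shrinks mv)) λ i' → ¬i (minus-one-back d i'))

mutual
  left-exclusive : ∀ {P} → LWins P → ¬ LLoses P
  left-exclusive (l-nomove none) (l-loses (Q , mv) _) = none Q mv
  left-exclusive (l-move mv rl) (l-loses _ replies) = right-exclusive (replies _ mv) rl

  right-exclusive : ∀ {P} → RWins P → ¬ RLoses P
  right-exclusive (r-nomove none) (r-loses (Q , mv) _) = none Q mv
  right-exclusive (r-move mv ll) (r-loses _ replies) = left-exclusive (replies _ mv) ll

left-wins-value : ∀ {P} → LWins P → In3ℕ (D P)
left-wins-value {P} lw with in3ℕ? (D P)
... | yes i = i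
... | no ¬i = ⊥-elim (left-exclusive lw (left-loses (<-wellFounded (sum P)) ¬i))

right-wins-value : ∀ {P} → RWins P → ¬ In3ℕ+1 (D P)
right-wins-value {P} rw i = right-exclusive rw (right-loses (<-wellFounded (sum P)) i)

locate : ∀ {Q : ℕ → Set} {P} → Any Q P →
         Σ Pos λ xs → Σ Pos λ ys → Σ ℕ λ n → (P ≡ xs ++ n ∷ ys) × Q n
locate any with n , n∈P , qn ← find any with xs , ys , eq ← ∈-∃++ n∈P =
  xs , ys , n , eq , qn

end-move-effect : ∀ xs ys a r s q δ → w a + w r ≡ w s + δ →
  D (xs ++ a ∷ (r ℕ.+ q * 3) ∷ ys) ≡ D (xs ++ (s ℕ.+ q * 3) ∷ ys) + δ
end-move-effect xs ys a r s q δ e =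
  D-replace xs ys a (r ℕ.+ q * 3) (s ℕ.+ q * 3) δ (begin
  w a + w (r ℕ.+ q * 3)   ≡⟨ cong (_+_ (w a)) (w-period r q) ⟩
  w a + w r               ≡⟨ e ⟩
  w s + δ                 ≡⟨ cong (_+ δ) (w-period s q) ⟨
  w (s ℕ.+ q * 3) + δ     ∎)
  where open ≡-Reasoning

left-end-1 : ∀ {P} → LWins P → Any (λ n → n % 3 ≡ 1) P → LeftEndWin 1 P
left-end-1 lw any with xs , ys , n , refl , h ← locate any
                  with q , refl ← mod3-form n h =
  xs , ys , q * 3 , refl , h ,
  right-loses (<-wellFounded _)
    (subst In3ℕ+1 (sym effect) (plus-one-step (left-wins-value lw)))
  where
  effect : D (xs ++ 0 ∷ q * 3 ∷ ys) ≡ D (xs ++ suc (q * 3) ∷ ys) + + 1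
  effect = end-move-effect xs ys 0 0 1 q (+ 1) refl

-- Left's square at the end of a strip of length 2 + 3q changes D by -2,
-- which is good when D > 0, as is the case without strips of length 1 + 3q.
left-end-2 : ∀ {P} → LWins P → ¬ Any (λ n → n % 3 ≡ 1) P →
             Any (λ n → n % 3 ≡ 2) P → LeftEndWin 2 P
left-end-2 lw no-1 any with xs , ys , n , refl , h ← locate any
                       with q , refl ← mod3-form n h =
  xs , ys , suc (q * 3) , refl , h ,
  right-loses (<-wellFounded _)
    (subst In3ℕ+1 (sym effect) (minus-two-step (left-wins-value lw) positive))
  where
  effect : D (xs ++ 0 ∷ suc (q * 3) ∷ ys) ≡
           D (xs ++ suc (suc (q * 3)) ∷ ys) + -[1+ 1 ]
  effect = end-move-effect xs ys 0 1 2 q -[1+ 1 ] refl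
  positive : + 0 <ℤ D (xs ++ suc (suc (q * 3)) ∷ ys)
  positive = D-pos (¬Any⇒All¬ _ no-1) any

right-end-2 : ∀ {P} → RWins P → Any (λ n → n % 3 ≡ 2) P → RightEndWin P
right-end-2 rw any with xs , ys , n , refl , h ← locate any
                   with q , refl ← mod3-form n h =
  xs , ys , q * 3 , refl , h ,
  left-loses (<-wellFounded _) (λ i → right-wins-value rw (minus-one-back effect i))
  where
  effect : D (xs ++ 0 ∷ q * 3 ∷ ys) ≡
           D (xs ++ suc (suc (q * 3)) ∷ ys) + -[1+ 0 ]
  effect = end-move-effect xs ys 0 0 2 q -[1+ 0 ] refl

right-near-end-1 : ∀ {P} → RWins P → Any (λ n → (n % 3 ≡ 1) × (3 ≤ n)) P →
                   RightNearEndWin P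
right-near-end-1 rw any with xs , ys , n , refl , (h , 3≤n) ← locate any
                        with mod3-form n h
... | zero , refl with s≤s () ← 3≤n
... | suc q , refl =
  xs , ys , suc (q * 3) , refl , h ,
  left-loses (<-wellFounded _) (λ i → right-wins-value rw (minus-one-back effect i))
  where
  effect : D (xs ++ 1 ∷ suc (q * 3) ∷ ys) ≡
           D (xs ++ suc (suc (suc (suc (q * 3)))) ∷ ys) + -[1+ 0 ]
  effect = end-move-effect xs ys 1 1 4 q -[1+ 0 ] refl

-- Theorem 4.5.  Right's move near the end of a strip of length 1 + 3q
-- (q ≥ 1) wins even when a strip of length ≡ 2 (mod 3) is present.
theorem4p5 : (P : Pos) →
    (LWins P →
      (Any (λ n → n % 3 ≡ 1) P → LeftEndWin 1 P)
      × (¬ Any (λ n → n % 3 ≡ 1) P → Any (λ n → n % 3 ≡ 2) P → LeftEndWin 2 P))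
    × (RWins P →
      (Any (λ n → n % 3 ≡ 2) P → RightEndWin P)
      × (¬ Any (λ n → n % 3 ≡ 2) P → Any (λ n → (n % 3 ≡ 1) × (3 ≤ n)) P → RightNearEndWin P))
theorem4p5 P =
  (λ lw → left-end-1 lw , left-end-2 lw) ,
  (λ rw → right-end-2 rw , λ _ → right-near-end-1 rw)
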